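{- For any two nonnegative integers $n, p$, $$\sum_{k=0}^n \binom{n}{k}\frac{s(k,p)}{k!} \;=\; (-1)^p\sum_{k=0}^n \frac{(-1)^k s(k,p)}{k!} \;=\; \frac{(-1)^{n-p}}{n!}\, s(n+1,p+1).$$
   Context: $s(n,k)$ denotes the (signed) Stirling numbers of the first kind, defined by $\frac{1}{p!}\ln^p(1+x) = \sum_{n\ge 0} s(n,p)\frac{x^n}{n!}$; in particular $s(0,0)=1$, $s(n,0)=0$ for $n\ge1$, and $s(n,p)=0$ for $n<p$. -}

module Defs where

open import Data.Nat as ℕ using (ℕ; zero; suc)
open import Data.Nat.Combinatorics using (_C_)
open import Data.Nat.Properties using (_!≢0)
open import Data.Integer as ℤ using (ℤ; +_)
open import Data.Rational using (ℚ; _/_; _+_; _*_; 0ℚ; 1ℚ; -_)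

-- Signed Stirling numbers of the first kind s(n,k), via the standard recurrence
-- s(0,0)=1, s(0,k+1)=0, s(n+1,0)=0, s(n+1,k+1) = s(n,k) - n * s(n,k+1),
-- which is equivalent to (1/p!) ln^p(1+x) = Σ s(n,p) x^n/n!.
stirling1 : ℕ → ℕ → ℤ
stirling1 zero    zero    = + 1
stirling1 zero    (suc k) = + 0
stirling1 (suc n) zero    = + 0
stirling1 (suc n) (suc k) = stirling1 n k ℤ.- (+ n) ℤ.* stirling1 n (suc k)

sign : ℕ → ℚ
sign zero    = 1ℚ
sign (suc m) = - sign m

Σ≤ : ℕ → (ℕ → ℚ) → ℚ
Σ≤ zero    f = f zero
Σ≤ (suc n) f = Σ≤ n f + f (suc n)

_/!_ : ℤ → ℕ → ℚ
(x /! m) = _/_ x (m ℕ.!) {{m !≢0}}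

binomℚ : ℕ → ℕ → ℚ
binomℚ n k = (+ (n C k)) / 1

{-# OPTIONS --safe #-}
-- Write a(k, p) = s(k, p) / k!.  Dividing the recurrence of s by k! gives
-- a(k, p) = (k+1) a(k+1, p+1) + k a(k, p+1), so the alternating sum telescopes:
-- Σ_{k≤n} (-1)^k a(k, p) = (-1)^n (n+1) a(n+1, p+1), which is the second equality.
-- For the first, both the binomial sum B(n, p) = Σ_k C(n,k) a(k, p) and the alternating
-- sum satisfy (n+1) F(n+1, p+1) = (n+1) F(n, p+1) + F(n, p); for B this follows from
-- Pascal's rule and (n+1) C(n+1,k) = (n+1) C(n,k) + k C(n+1,k).  The two agree for
-- n = 0 and for p = 0, and these values determine F.
module Submission where

open import Algebra.Definitions using (Congruent₂)
open import Data.Integer as ℤ using (ℤ; +_)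
import Data.Integer.Properties as ℤ
import Data.Integer.Tactic.RingSolver as ℤ-Solver
open import Data.Nat as ℕ using (ℕ; zero; suc; _!)
import Data.Nat.Properties as ℕ
open import Data.Nat.Combinatorics using (_C_; nCk+nC[k+1]≡[n+1]C[k+1]; k>n⇒nCk≡0; nC1≡n)
import Data.Nat.Tactic.RingSolver as ℕ-Solver
open import Data.Product using (_×_; _,_)
open import Data.Rational using (ℚ; _/_; _+_; _*_; -_; 0ℚ; 1ℚ; 1/_; NonZero; toℚᵘ; fromℚᵘ)
open import Data.Rational.Properties
  using ( _≟_; +-*-commutativeRing; toℚᵘ-fromℚᵘ; fromℚᵘ-toℚᵘ; fromℚᵘ-cong; toℚᵘ-homo-+; toℚᵘ-homo-*
        ; 0/n≡0; normalize-pos; pos⇒nonZero; *-inverseˡ; *-assoc; *-identityˡ; *-zeroʳ; +-identityʳ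
        ; *-distribˡ-+; *-distribʳ-+; *-zeroˡ; neg-distribˡ-* )
open import Data.Rational.Unnormalised as ℚᵘ using (ℚᵘ; mkℚᵘ; *≡*; _≃_)
import Data.Rational.Unnormalised.Properties as ℚᵘ
open import Level using (0ℓ)
open import Relation.Binary.PropositionalEquality
open import Relation.Nullary.Decidable using (dec⇒maybe)
open import Tactic.RingSolver using (solve-∀)
open import Tactic.RingSolver.Core.AlmostCommutativeRing
  using (AlmostCommutativeRing; fromCommutativeRing)

open import Defs

open ≡-Reasoning

ℚ-ring : AlmostCommutativeRing 0ℓ 0ℓ
ℚ-ring = fromCommutativeRing +-*-commutativeRing (λ x → dec⇒maybe (0ℚ ≟ x))

-- x / suc d is definitionally fromℚᵘ (mkℚᵘ x d), so identities for _/_ are proved in ℚᵘ.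
fromℚᵘ-homo : ∀ {_∙ᵘ_ : ℚᵘ → ℚᵘ → ℚᵘ} {_∙_ : ℚ → ℚ → ℚ} → Congruent₂ _≃_ _∙ᵘ_ →
              (∀ p q → toℚᵘ (p ∙ q) ≃ toℚᵘ p ∙ᵘ toℚᵘ q) →
              ∀ p q → fromℚᵘ (p ∙ᵘ q) ≡ fromℚᵘ p ∙ fromℚᵘ q
fromℚᵘ-homo {_∙ᵘ_} {_∙_} ∙ᵘ-cong toℚᵘ-homo p q = begin
  fromℚᵘ (p ∙ᵘ q)                               ≡⟨ fromℚᵘ-cong (∙ᵘ-cong (back p) (back q)) ⟩
  fromℚᵘ (toℚᵘ (fromℚᵘ p) ∙ᵘ toℚᵘ (fromℚᵘ q))   ≡⟨ fromℚᵘ-cong (ℚᵘ.≃-sym (toℚᵘ-homo _ _)) ⟩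
  fromℚᵘ (toℚᵘ (fromℚᵘ p ∙ fromℚᵘ q))          ≡⟨ fromℚᵘ-toℚᵘ _ ⟩
  fromℚᵘ p ∙ fromℚᵘ q                           ∎
  where
  back : ∀ r → r ≃ toℚᵘ (fromℚᵘ r)
  back r = ℚᵘ.≃-sym (toℚᵘ-fromℚᵘ r)

fromℤ : ℤ → ℚ
fromℤ x = x / 1

fromℕ : ℕ → ℚ
fromℕ m = fromℤ (+ m)

/-distribʳ-+ : ∀ x y d .{{_ : ℕ.NonZero d}} → (x ℤ.+ y) / d ≡ x / d + y / d
/-distribʳ-+ x y (suc d) = trans
  (fromℚᵘ-cong {mkℚᵘ (x ℤ.+ y) d} {mkℚᵘ x d ℚᵘ.+ mkℚᵘ y d} (*≡* (cross x y (+ suc d))))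
  (fromℚᵘ-homo ℚᵘ.+-cong toℚᵘ-homo-+ (mkℚᵘ x d) (mkℚᵘ y d))
  where
  cross : ∀ x y e → (x ℤ.+ y) ℤ.* (e ℤ.* e) ≡ (x ℤ.* e ℤ.+ y ℤ.* e) ℤ.* e
  cross = ℤ-Solver.solve-∀

/-*ˡ : ∀ x y d .{{_ : ℕ.NonZero d}} → (x ℤ.* y) / d ≡ fromℤ x * (y / d)
/-*ˡ x y (suc d) = trans
  (fromℚᵘ-cong {mkℚᵘ (x ℤ.* y) d} {mkℚᵘ x 0 ℚᵘ.* mkℚᵘ y d}
     (*≡* (cong (λ e → x ℤ.* y ℤ.* + suc e) (ℕ.+-identityʳ d))))
  (fromℚᵘ-homo ℚᵘ.*-cong toℚᵘ-homo-* (mkℚᵘ x 0) (mkℚᵘ y d))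

fromℕ-*-/-cancelˡ : ∀ m x d .{{_ : ℕ.NonZero d}} →
  fromℕ (suc m) * _/_ x (suc m ℕ.* d) {{ℕ.m*n≢0 (suc m) d}} ≡ x / d
fromℕ-*-/-cancelˡ m x (suc d) = sym (trans
  (fromℚᵘ-cong {mkℚᵘ x d} {mkℚᵘ (+ suc m) 0 ℚᵘ.* mkℚᵘ x (d ℕ.+ m ℕ.* suc d)} (*≡* (begin
    x ℤ.* + suc (d ℕ.+ m ℕ.* suc d ℕ.+ 0)   ≡⟨ cong (λ e → x ℤ.* + suc e) (ℕ.+-identityʳ _) ⟩
    x ℤ.* + (suc m ℕ.* suc d)              ≡⟨ cong (x ℤ.*_) (ℤ.pos-* (suc m) (suc d)) ⟩
    x ℤ.* (+ suc m ℤ.* + suc d)            ≡⟨ reorder x (+ suc m) (+ suc d) ⟩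
    + suc m ℤ.* x ℤ.* + suc d              ∎)))
  (fromℚᵘ-homo ℚᵘ.*-cong toℚᵘ-homo-* (mkℚᵘ (+ suc m) 0) (mkℚᵘ x (d ℕ.+ m ℕ.* suc d))))
  where
  reorder : ∀ x a b → x ℤ.* (a ℤ.* b) ≡ a ℤ.* x ℤ.* b
  reorder = ℤ-Solver.solve-∀

fromℕ-homo-+ : ∀ a b → fromℕ (a ℕ.+ b) ≡ fromℕ a + fromℕ b
fromℕ-homo-+ a b = trans (cong fromℤ (ℤ.pos-+ a b)) (/-distribʳ-+ (+ a) (+ b) 1)

fromℕ-homo-* : ∀ a b → fromℕ (a ℕ.* b) ≡ fromℕ a * fromℕ b
fromℕ-homo-* a b = trans (cong fromℤ (ℤ.pos-* a b)) (/-*ˡ (+ a) (+ b) 1)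

fromℕ-suc-*-cancelˡ : ∀ n {x y} → fromℕ (suc n) * x ≡ fromℕ (suc n) * y → x ≡ y
fromℕ-suc-*-cancelˡ n {x} {y} eq = trans (sym (undo x)) (trans (cong (1/ c *_) eq) (undo y))
  where
  c = fromℕ (suc n)
  instance
    c≢0 : NonZero c
    c≢0 = pos⇒nonZero c {{normalize-pos (suc n) 1}}
  undo : ∀ z → 1/ c * (c * z) ≡ z
  undo z = trans (sym (*-assoc (1/ c) c z)) (trans (cong (_* z) (*-inverseˡ c)) (*-identityˡ z))

sign-+ : ∀ m n → sign (m ℕ.+ n) ≡ sign m * sign n
sign-+ zero    n = sym (*-identityˡ (sign n))
sign-+ (suc m) n = trans (cong -_ (sign-+ m n)) (neg-distribˡ-* (sign m) (sign n))

Σ≤-cong : ∀ {f g : ℕ → ℚ} → (∀ k → f k ≡ g k) → ∀ n → Σ≤ n f ≡ Σ≤ n g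
Σ≤-cong f≗g zero    = f≗g 0
Σ≤-cong f≗g (suc n) = cong₂ _+_ (Σ≤-cong f≗g n) (f≗g (suc n))

Σ≤-distrib-+ : ∀ (f g : ℕ → ℚ) n → Σ≤ n (λ k → f k + g k) ≡ Σ≤ n f + Σ≤ n g
Σ≤-distrib-+ f g zero    = refl
Σ≤-distrib-+ f g (suc n) =
  trans (cong (_+ (f (suc n) + g (suc n))) (Σ≤-distrib-+ f g n))
        (interchange (Σ≤ n f) (Σ≤ n g) (f (suc n)) (g (suc n)))
  where
  interchange : ∀ a b c d → (a + b) + (c + d) ≡ (a + c) + (b + d)
  interchange = solve-∀ ℚ-ring

Σ≤-distribˡ-* : ∀ c (f : ℕ → ℚ) n → Σ≤ n (λ k → c * f k) ≡ c * Σ≤ n f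
Σ≤-distribˡ-* c f zero    = refl
Σ≤-distribˡ-* c f (suc n) =
  trans (cong (_+ c * f (suc n)) (Σ≤-distribˡ-* c f n)) (sym (*-distribˡ-+ c (Σ≤ n f) (f (suc n))))

Σ≤-suc : ∀ (f : ℕ → ℚ) n → Σ≤ (suc n) f ≡ f 0 + Σ≤ n (λ k → f (suc k))
Σ≤-suc f zero    = refl
Σ≤-suc f (suc n) =
  trans (cong (_+ f (suc (suc n))) (Σ≤-suc f n))
        (+-assoc (f 0) (Σ≤ n (λ k → f (suc k))) (f (suc (suc n))))
  where
  +-assoc : ∀ a b c → (a + b) + c ≡ a + (b + c)
  +-assoc = solve-∀ ℚ-ring

Σ≤-suc-vanishing : ∀ (f : ℕ → ℚ) n → f (suc n) ≡ 0ℚ → Σ≤ (suc n) f ≡ Σ≤ n f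
Σ≤-suc-vanishing f n fn≡0 = trans (cong (λ z → Σ≤ n f + z) fn≡0) (+-identityʳ (Σ≤ n f))

Σ≤-concentrated : ∀ (f : ℕ → ℚ) → (∀ k → f (suc k) ≡ 0ℚ) → ∀ n → Σ≤ n f ≡ f 0
Σ≤-concentrated f f≡0 zero    = refl
Σ≤-concentrated f f≡0 (suc n) =
  trans (Σ≤-suc-vanishing f n (f≡0 n)) (Σ≤-concentrated f f≡0 n)

[k+1]*[n+1]C[k+1]≡[n+1]*nCk : ∀ n k → suc k ℕ.* (suc n C suc k) ≡ suc n ℕ.* (n C k)
[k+1]*[n+1]C[k+1]≡[n+1]*nCk zero    zero    = refl
[k+1]*[n+1]C[k+1]≡[n+1]*nCk zero    (suc k) = ℕ.*-zeroʳ (suc (suc k))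
[k+1]*[n+1]C[k+1]≡[n+1]*nCk (suc n) zero    =
  trans (ℕ.*-identityˡ _) (trans (nC1≡n (suc (suc n))) (sym (ℕ.*-identityʳ (suc (suc n)))))
[k+1]*[n+1]C[k+1]≡[n+1]*nCk (suc n) (suc k) = begin
  suc (suc k) ℕ.* (suc (suc n) C suc (suc k))
    ≡⟨ cong (suc (suc k) ℕ.*_) (nCk+nC[k+1]≡[n+1]C[k+1] (suc n) (suc k)) ⟨
  suc (suc k) ℕ.* (suc n C suc k ℕ.+ suc n C suc (suc k))
    ≡⟨ regroup k (suc n C suc k) (suc n C suc (suc k)) ⟩
  suc n C suc k ℕ.+ (suc k ℕ.* (suc n C suc k) ℕ.+ suc (suc k) ℕ.* (suc n C suc (suc k)))
    ≡⟨ cong₂ (λ a b → suc n C suc k ℕ.+ (a ℕ.+ b))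
         ([k+1]*[n+1]C[k+1]≡[n+1]*nCk n k) ([k+1]*[n+1]C[k+1]≡[n+1]*nCk n (suc k)) ⟩
  suc n C suc k ℕ.+ (suc n ℕ.* (n C k) ℕ.+ suc n ℕ.* (n C suc k))
    ≡⟨ cong (suc n C suc k ℕ.+_) (ℕ.*-distribˡ-+ (suc n) (n C k) (n C suc k)) ⟨
  suc n C suc k ℕ.+ suc n ℕ.* (n C k ℕ.+ n C suc k)
    ≡⟨ cong (λ a → suc n C suc k ℕ.+ suc n ℕ.* a) (nCk+nC[k+1]≡[n+1]C[k+1] n k) ⟩
  suc (suc n) ℕ.* (suc n C suc k) ∎
  where
  regroup : ∀ k a b → suc (suc k) ℕ.* (a ℕ.+ b) ≡ a ℕ.+ (suc k ℕ.* a ℕ.+ suc (suc k) ℕ.* b)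
  regroup = ℕ-Solver.solve-∀

[n+1]*[n+1]Ck≡[n+1]*nCk+k*[n+1]Ck : ∀ n k →
  suc n ℕ.* (suc n C k) ≡ suc n ℕ.* (n C k) ℕ.+ k ℕ.* (suc n C k)
[n+1]*[n+1]Ck≡[n+1]*nCk+k*[n+1]Ck n zero    = sym (ℕ.+-identityʳ _)
[n+1]*[n+1]Ck≡[n+1]*nCk+k*[n+1]Ck n (suc k) = begin
  suc n ℕ.* (suc n C suc k)
    ≡⟨ cong (suc n ℕ.*_) (nCk+nC[k+1]≡[n+1]C[k+1] n k) ⟨
  suc n ℕ.* (n C k ℕ.+ n C suc k)
    ≡⟨ ℕ.*-distribˡ-+ (suc n) (n C k) (n C suc k) ⟩
  suc n ℕ.* (n C k) ℕ.+ suc n ℕ.* (n C suc k)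
    ≡⟨ cong (ℕ._+ suc n ℕ.* (n C suc k)) ([k+1]*[n+1]C[k+1]≡[n+1]*nCk n k) ⟨
  suc k ℕ.* (suc n C suc k) ℕ.+ suc n ℕ.* (n C suc k)
    ≡⟨ ℕ.+-comm (suc k ℕ.* (suc n C suc k)) (suc n ℕ.* (n C suc k)) ⟩
  suc n ℕ.* (n C suc k) ℕ.+ suc k ℕ.* (suc n C suc k) ∎

binomialSum : ℕ → (ℕ → ℚ) → ℚ
binomialSum n g = Σ≤ n (λ k → binomℚ n k * g k)

binomℚ-pascal : ∀ n k → binomℚ n k + binomℚ n (suc k) ≡ binomℚ (suc n) (suc k)
binomℚ-pascal n k = trans (sym (fromℕ-homo-+ (n C k) (n C suc k))) (cong fromℕ (nCk+nC[k+1]≡[n+1]C[k+1] n k))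

binomℚ-vanishing : ∀ n → binomℚ n (suc n) ≡ 0ℚ
binomℚ-vanishing n = cong fromℕ (k>n⇒nCk≡0 (ℕ.n<1+n n))

binomialSum-pascal : ∀ n (h : ℕ → ℚ) →
  binomialSum n (λ k → h (suc k) + h k) ≡ binomialSum (suc n) h
binomialSum-pascal n h = begin
  binomialSum n (λ k → h (suc k) + h k)
    ≡⟨ Σ≤-cong (λ k → *-distribˡ-+ (binomℚ n k) (h (suc k)) (h k)) n ⟩
  Σ≤ n (λ k → binomℚ n k * h (suc k) + binomℚ n k * h k)
    ≡⟨ Σ≤-distrib-+ (λ k → binomℚ n k * h (suc k)) (λ k → binomℚ n k * h k) n ⟩
  S₀ + binomialSum n h
    ≡⟨ cong (_+_ S₀) lower ⟩
  S₀ + (1ℚ * h 0 + S₁)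
    ≡⟨ rearrange S₀ (1ℚ * h 0) S₁ ⟩
  1ℚ * h 0 + (S₀ + S₁)
    ≡⟨ cong (_+_ (1ℚ * h 0)) upper ⟩
  1ℚ * h 0 + Σ≤ n (λ k → binomℚ (suc n) (suc k) * h (suc k))
    ≡⟨ Σ≤-suc (λ k → binomℚ (suc n) k * h k) n ⟨
  binomialSum (suc n) h ∎
  where
  S₀ S₁ : ℚ
  S₀ = Σ≤ n (λ k → binomℚ n k * h (suc k))
  S₁ = Σ≤ n (λ k → binomℚ n (suc k) * h (suc k))
  lower : binomialSum n h ≡ 1ℚ * h 0 + S₁
  lower = trans (sym (Σ≤-suc-vanishing (λ k → binomℚ n k * h k) n
                       (trans (cong (_* h (suc n)) (binomℚ-vanishing n)) (*-zeroˡ (h (suc n))))))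
                (Σ≤-suc (λ k → binomℚ n k * h k) n)
  pascal : ∀ k → binomℚ n k * h (suc k) + binomℚ n (suc k) * h (suc k) ≡ binomℚ (suc n) (suc k) * h (suc k)
  pascal k = trans (sym (*-distribʳ-+ (h (suc k)) (binomℚ n k) (binomℚ n (suc k))))
                   (cong (_* h (suc k)) (binomℚ-pascal n k))
  upper : S₀ + S₁ ≡ Σ≤ n (λ k → binomℚ (suc n) (suc k) * h (suc k))
  upper = trans (sym (Σ≤-distrib-+ (λ k → binomℚ n k * h (suc k)) (λ k → binomℚ n (suc k) * h (suc k)) n))
                (Σ≤-cong pascal n)
  rearrange : ∀ a b c → a + (b + c) ≡ b + (a + c)
  rearrange = solve-∀ ℚ-ring

binomialSum-suc : ∀ n (g : ℕ → ℚ) →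
  fromℕ (suc n) * binomialSum (suc n) g ≡
  fromℕ (suc n) * binomialSum n g + binomialSum (suc n) (λ k → fromℕ k * g k)
binomialSum-suc n g = begin
  c * binomialSum (suc n) g
    ≡⟨ Σ≤-distribˡ-* c (λ k → binomℚ (suc n) k * g k) (suc n) ⟨
  Σ≤ (suc n) (λ k → c * (binomℚ (suc n) k * g k))
    ≡⟨ Σ≤-cong split (suc n) ⟩
  Σ≤ (suc n) (λ k → c * (binomℚ n k * g k) + binomℚ (suc n) k * (fromℕ k * g k))
    ≡⟨ Σ≤-distrib-+ (λ k → c * (binomℚ n k * g k)) (λ k → binomℚ (suc n) k * (fromℕ k * g k)) (suc n) ⟩
  Σ≤ (suc n) (λ k → c * (binomℚ n k * g k)) + binomialSum (suc n) (λ k → fromℕ k * g k)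
    ≡⟨ cong (_+ binomialSum (suc n) (λ k → fromℕ k * g k)) truncate ⟩
  c * binomialSum n g + binomialSum (suc n) (λ k → fromℕ k * g k) ∎
  where
  c = fromℕ (suc n)
  absorb : ∀ k → c * binomℚ (suc n) k ≡ c * binomℚ n k + fromℕ k * binomℚ (suc n) k
  absorb k = begin
    c * binomℚ (suc n) k                                ≡⟨ fromℕ-homo-* (suc n) (suc n C k) ⟨
    fromℕ (suc n ℕ.* (suc n C k))                       ≡⟨ cong fromℕ ([n+1]*[n+1]Ck≡[n+1]*nCk+k*[n+1]Ck n k) ⟩
    fromℕ (suc n ℕ.* (n C k) ℕ.+ k ℕ.* (suc n C k))     ≡⟨ fromℕ-homo-+ (suc n ℕ.* (n C k)) (k ℕ.* (suc n C k)) ⟩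
    fromℕ (suc n ℕ.* (n C k)) + fromℕ (k ℕ.* (suc n C k))
      ≡⟨ cong₂ _+_ (fromℕ-homo-* (suc n) (n C k)) (fromℕ-homo-* k (suc n C k)) ⟩
    c * binomℚ n k + fromℕ k * binomℚ (suc n) k         ∎
  split : ∀ k → c * (binomℚ (suc n) k * g k) ≡ c * (binomℚ n k * g k) + binomℚ (suc n) k * (fromℕ k * g k)
  split k = begin
    c * (binomℚ (suc n) k * g k)                       ≡⟨ *-assoc c (binomℚ (suc n) k) (g k) ⟨
    c * binomℚ (suc n) k * g k                         ≡⟨ cong (_* g k) (absorb k) ⟩
    (c * binomℚ n k + fromℕ k * binomℚ (suc n) k) * g k ≡⟨ expand c (binomℚ n k) (fromℕ k) (binomℚ (suc n) k) (g k) ⟩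
    c * (binomℚ n k * g k) + binomℚ (suc n) k * (fromℕ k * g k) ∎
    where
    expand : ∀ c b x b′ y → (c * b + x * b′) * y ≡ c * (b * y) + b′ * (x * y)
    expand = solve-∀ ℚ-ring
  truncate : Σ≤ (suc n) (λ k → c * (binomℚ n k * g k)) ≡ c * binomialSum n g
  truncate = trans
    (Σ≤-suc-vanishing (λ k → c * (binomℚ n k * g k)) n
      (trans (cong (λ b → c * (b * g (suc n))) (binomℚ-vanishing n))
             (trans (cong (c *_) (*-zeroˡ (g (suc n)))) (*-zeroʳ c))))
    (Σ≤-distribˡ-* c (λ k → binomℚ n k * g k) n)

Recurrence : (ℕ → ℕ → ℚ) → Set
Recurrence F = ∀ n p → fromℕ (suc n) * F (suc n) (suc p) ≡ fromℕ (suc n) * F n (suc p) + F n p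

Recurrence-unique : ∀ {F G} → Recurrence F → Recurrence G →
  (∀ p → F 0 p ≡ G 0 p) → (∀ n → F n 0 ≡ G n 0) → ∀ n p → F n p ≡ G n p
Recurrence-unique {F} {G} recF recG F≡G₀ₚ F≡Gₙ₀ = go
  where
  go : ∀ n p → F n p ≡ G n p
  go zero    p       = F≡G₀ₚ p
  go (suc n) zero    = F≡Gₙ₀ (suc n)
  go (suc n) (suc p) = fromℕ-suc-*-cancelˡ n (begin
    fromℕ (suc n) * F (suc n) (suc p)     ≡⟨ recF n p ⟩
    fromℕ (suc n) * F n (suc p) + F n p   ≡⟨ cong₂ (λ u v → fromℕ (suc n) * u + v) (go n (suc p)) (go n p) ⟩
    fromℕ (suc n) * G n (suc p) + G n p   ≡⟨ recG n p ⟨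
    fromℕ (suc n) * G (suc n) (suc p)     ∎)

stirling1/! : ℕ → ℕ → ℚ
stirling1/! k p = stirling1 k p /! k

stirling1-rec : ∀ k p → stirling1 (suc k) (suc p) ℤ.+ + k ℤ.* stirling1 k (suc p) ≡ stirling1 k p
stirling1-rec k p = cancel (stirling1 k p) (+ k ℤ.* stirling1 k (suc p))
  where
  cancel : ∀ a b → a ℤ.- b ℤ.+ b ≡ a
  cancel = ℤ-Solver.solve-∀

stirling1/!-rec : ∀ k p →
  fromℕ (suc k) * stirling1/! (suc k) (suc p) + fromℕ k * stirling1/! k (suc p) ≡ stirling1/! k p
stirling1/!-rec k p = begin
  fromℕ (suc k) * stirling1/! (suc k) (suc p) + fromℕ k * stirling1/! k (suc p)
    ≡⟨ cong₂ _+_ (fromℕ-*-/-cancelˡ k (stirling1 (suc k) (suc p)) (k !) {{k ℕ.!≢0}})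
                 (sym (/-*ˡ (+ k) (stirling1 k (suc p)) (k !) {{k ℕ.!≢0}})) ⟩
  stirling1 (suc k) (suc p) /! k + (+ k ℤ.* stirling1 k (suc p)) /! k
    ≡⟨ /-distribʳ-+ (stirling1 (suc k) (suc p)) (+ k ℤ.* stirling1 k (suc p)) (k !) {{k ℕ.!≢0}} ⟨
  (stirling1 (suc k) (suc p) ℤ.+ + k ℤ.* stirling1 k (suc p)) /! k
    ≡⟨ cong (_/! k) (stirling1-rec k p) ⟩
  stirling1/! k p ∎

stirling1/!-suc-zero : ∀ k → stirling1/! (suc k) 0 ≡ 0ℚ
stirling1/!-suc-zero k = 0/n≡0 (suc k !) {{suc k ℕ.!≢0}}

alternatingSum : ℕ → ℕ → ℚ
alternatingSum n p = sign p * Σ≤ n (λ k → sign k * stirling1/! k p)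

Σ≤-sign*stirling1/!-telescopes : ∀ n p →
  Σ≤ n (λ k → sign k * stirling1/! k p) ≡ sign n * (fromℕ (suc n) * stirling1/! (suc n) (suc p))
Σ≤-sign*stirling1/!-telescopes zero    p =
  cong (1ℚ *_) (trans (sym (stirling1/!-rec 0 p)) (drop (fromℕ 1 * stirling1/! 1 (suc p)) (stirling1/! 0 (suc p))))
  where
  drop : ∀ a b → a + 0ℚ * b ≡ a
  drop = solve-∀ ℚ-ring
Σ≤-sign*stirling1/!-telescopes (suc n) p = begin
  Σ≤ n (λ k → sign k * stirling1/! k p) + sign (suc n) * stirling1/! (suc n) p
    ≡⟨ cong₂ (λ u v → u + sign (suc n) * v)
             (Σ≤-sign*stirling1/!-telescopes n p) (sym (stirling1/!-rec (suc n) p)) ⟩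
  sign n * X + (- sign n) * (Y + X)
    ≡⟨ telescope (sign n) X Y ⟩
  (- sign n) * Y ∎
  where
  X = fromℕ (suc n) * stirling1/! (suc n) (suc p)
  Y = fromℕ (suc (suc n)) * stirling1/! (suc (suc n)) (suc p)
  telescope : ∀ s x y → s * x + (- s) * (y + x) ≡ (- s) * y
  telescope = solve-∀ ℚ-ring

alternatingSum-telescoped : ∀ n p →
  alternatingSum n p ≡ sign p * (sign n * (fromℕ (suc n) * stirling1/! (suc n) (suc p)))
alternatingSum-telescoped n p = cong (sign p *_) (Σ≤-sign*stirling1/!-telescopes n p)

alternatingSum-recurrence : Recurrence alternatingSum
alternatingSum-recurrence n p = begin
  c * alternatingSum (suc n) (suc p)
    ≡⟨ cong (c *_) (alternatingSum-telescoped (suc n) (suc p)) ⟩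
  c * ((- sign p) * ((- sign n) * Y))
    ≡⟨ regroup c (sign p) (sign n) Y X ⟩
  c * ((- sign p) * (sign n * X)) + sign p * (sign n * (c * (Y + X)))
    ≡⟨ cong (λ v → c * ((- sign p) * (sign n * X)) + sign p * (sign n * (c * v))) (stirling1/!-rec (suc n) (suc p)) ⟩
  c * ((- sign p) * (sign n * X)) + sign p * (sign n * (c * stirling1/! (suc n) (suc p)))
    ≡⟨ cong₂ (λ u v → c * u + v) (alternatingSum-telescoped n (suc p)) (alternatingSum-telescoped n p) ⟨
  c * alternatingSum n (suc p) + alternatingSum n p ∎
  where
  c = fromℕ (suc n)
  X = fromℕ (suc n) * stirling1/! (suc n) (suc (suc p))
  Y = fromℕ (suc (suc n)) * stirling1/! (suc (suc n)) (suc (suc p))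
  regroup : ∀ c s t y x → c * ((- s) * ((- t) * y)) ≡ c * ((- s) * (t * x)) + s * (t * (c * (y + x)))
  regroup = solve-∀ ℚ-ring

alternatingSum-closedForm : ∀ n p →
  alternatingSum n p ≡ sign (n ℕ.+ p) * (stirling1 (suc n) (suc p) /! n)
alternatingSum-closedForm n p = begin
  alternatingSum n p
    ≡⟨ alternatingSum-telescoped n p ⟩
  sign p * (sign n * (fromℕ (suc n) * stirling1/! (suc n) (suc p)))
    ≡⟨ swap (sign p) (sign n) _ ⟩
  sign n * sign p * (fromℕ (suc n) * stirling1/! (suc n) (suc p))
    ≡⟨ cong₂ _*_ (sym (sign-+ n p)) (fromℕ-*-/-cancelˡ n (stirling1 (suc n) (suc p)) (n !) {{n ℕ.!≢0}}) ⟩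
  sign (n ℕ.+ p) * (stirling1 (suc n) (suc p) /! n) ∎
  where
  swap : ∀ a b x → a * (b * x) ≡ b * a * x
  swap = solve-∀ ℚ-ring

binomialSum-stirling1/!-recurrence : Recurrence (λ n p → binomialSum n (λ k → stirling1/! k p))
binomialSum-stirling1/!-recurrence n p = begin
  c * binomialSum (suc n) (a (suc p))
    ≡⟨ binomialSum-suc n (a (suc p)) ⟩
  c * binomialSum n (a (suc p)) + binomialSum (suc n) h
    ≡⟨ cong (_+_ (c * binomialSum n (a (suc p)))) (binomialSum-pascal n h) ⟨
  c * binomialSum n (a (suc p)) + binomialSum n (λ k → h (suc k) + h k)
    ≡⟨ cong (_+_ (c * binomialSum n (a (suc p))))
            (Σ≤-cong (λ k → cong (binomℚ n k *_) (stirling1/!-rec k p)) n) ⟩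
  c * binomialSum n (a (suc p)) + binomialSum n (a p) ∎
  where
  c = fromℕ (suc n)
  a : ℕ → ℕ → ℚ
  a q k = stirling1/! k q
  h : ℕ → ℚ
  h k = fromℕ k * a (suc p) k

binomialSum≡alternatingSum : ∀ n p → binomialSum n (λ k → stirling1/! k p) ≡ alternatingSum n p
binomialSum≡alternatingSum = Recurrence-unique
  binomialSum-stirling1/!-recurrence alternatingSum-recurrence initial edge
  where
  initial : ∀ p → binomialSum 0 (λ k → stirling1/! k p) ≡ alternatingSum 0 p
  initial zero    = refl
  initial (suc p) = sym (*-zeroʳ (sign (suc p)))
  vanish : ∀ x k → x * stirling1/! (suc k) 0 ≡ 0ℚ
  vanish x k = trans (cong (x *_) (stirling1/!-suc-zero k)) (*-zeroʳ x)
  edge : ∀ n → binomialSum n (λ k → stirling1/! k 0) ≡ alternatingSum n 0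
  edge n = trans (Σ≤-concentrated _ (λ k → vanish (binomℚ n (suc k)) k) n)
                 (sym (cong (1ℚ *_) (Σ≤-concentrated _ (λ k → vanish (sign (suc k)) k) n)))

proposition5 : (n p : ℕ) →
    (Σ≤ n (λ k → binomℚ n k * (stirling1 k p /! k))
      ≡ sign p * Σ≤ n (λ k → sign k * (stirling1 k p /! k)))
    × (sign p * Σ≤ n (λ k → sign k * (stirling1 k p /! k))
      ≡ sign (n ℕ.+ p) * (stirling1 (n ℕ.+ 1) (p ℕ.+ 1) /! n))
proposition5 n p =
  binomialSum≡alternatingSum n p ,
  trans (alternatingSum-closedForm n p)
        (cong₂ (λ m q → sign (n ℕ.+ p) * (stirling1 m q /! n)) (ℕ.+-comm 1 n) (ℕ.+-comm 1 p))
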